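{- For every directed temporal graph $\mathcal{G}$, considered with strict temporal paths, there exist a simple and proper directed temporal graph $\mathcal{H}$ and a map $\sigma\colon V(\mathcal{G})\to V(\mathcal{H})$ such that for all $u,v\in V(\mathcal{G})$: $(u,v)\in\mathcal{R}(\mathcal{G})$ if and only if $(\sigma(u),\sigma(v))\in\mathcal{R}(\mathcal{H})$.
   Context: A directed temporal graph is a triple $(V,E,\lambda)$ with $V$ finite, $E\subseteq\{(u,v)\in V\times V:u\ne v\}$, and $\lambda$ assigning each arc a nonempty finite set of time labels; it is simple if every arc has exactly one label, and proper if no two distinct arcs incident to a common vertex share a label. A temporal path from $u$ to $v$ is a sequence $(e_1,t_1),\dots,(e_k,t_k)$, $k\ge1$, $t_i\in\lambda(e_i)$, with $e_1,\dots,e_k$ a directed path from $u$ to $v$ (distinct vertices) and $t_1\le\dots\le t_k$; it is strict if $t_1<\dots<t_k$. $\mathcal{R}(\mathcal{G})$ is the static directed graph on $V(\mathcal{G})$ with arc $(u,v)$, $u\ne v$, iff there is a strict temporal path from $u$ to $v$ in $\mathcal{G}$; $\mathcal{R}(\mathcal{H})$ is defined likewise (in a proper graph every temporal path is strict). -}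

module Defs where

open import Data.Nat using (ℕ; suc; _<_)
open import Data.Fin using (Fin; zero; fromℕ; inject₁) renaming (suc to fsuc)
open import Data.List using (List; [])
open import Data.List.Membership.Propositional using (_∈_)
open import Data.List.Relation.Unary.Unique.Propositional using (Unique)
open import Data.Product using (Σ; _×_; ∃)
open import Relation.Binary.PropositionalEquality using (_≡_; _≢_)
open import Relation.Nullary using (¬_)
open import Function.Definitions using (Injective)

-- A directed temporal graph on vertex set Fin n (any finite V is in bijection
-- with some Fin n). Time labels are natural numbers. λ u v is the list of
-- labels of arc (u,v); the arc (u,v) is in E iff λ u v is nonempty.
record TemporalGraph : Set where
  field
    n     : ℕ
    label : Fin n → Fin n → List ℕ
    noLoop : (u : Fin n) → label u u ≡ []

open TemporalGraph public

V : TemporalGraph → Set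
V G = Fin (n G)

IsArc : (G : TemporalGraph) → V G → V G → Set
IsArc G u v = label G u v ≢ []

Simple : TemporalGraph → Set
Simple G = (u v : V G) → IsArc G u v → Σ ℕ λ t → label G u v ≡ t Data.List.∷ []

ShareVertex : ∀ {m} → Fin m → Fin m → Fin m → Fin m → Set
ShareVertex a b c d = (a ≡ c) Data.Sum.⊎ (a ≡ d) Data.Sum.⊎ (b ≡ c) Data.Sum.⊎ (b ≡ d)
  where import Data.Sum

Proper : TemporalGraph → Set
Proper G = (a b c d : V G) → IsArc G a b → IsArc G c d →
           ¬ ((a ≡ c) × (b ≡ d)) → ShareVertex a b c d →
           (t : ℕ) → t ∈ label G a b → ¬ (t ∈ label G c d)

record StrictTemporalPath (G : TemporalGraph) (u v : V G) : Set where
  field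
    k        : ℕ
    kPos     : 0 < k
    vert     : Fin (suc k) → V G
    distinct : Injective _≡_ _≡_ vert
    start    : vert zero ≡ u
    end      : vert (fromℕ k) ≡ v
    time     : Fin k → ℕ
    onArc    : (i : Fin k) → time i ∈ label G (vert (inject₁ i)) (vert (fsuc i))
    strict   : (i j : Fin k) → Data.Fin._<_ i j → time i < time j

ReachArc : (G : TemporalGraph) → V G → V G → Set
ReachArc G u v = (u ≢ v) × StrictTemporalPath G u v

-- Any loopless relation D on a finite set is the reachability relation, restricted to
-- an embedded copy of the set, of a simple proper temporal graph: for every pair p = (a , b)
-- with D a b add a vertex p, an arc a → p at time p and an arc p → b at time n² + p.
-- Every time labels a single arc, so the graph is simple and proper; a strict path out of a
-- vertex a must go up to a pair vertex, down to its target, and can go no further, since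
-- upward times lie below n² ≤ every downward time. The reachability relation of a temporal
-- graph is loopless and, since a path visits at most n vertices and takes its times among
-- the finitely many labels, decidable.
module Submission where

open import Defs
open import Level using (0ℓ)
open import Data.Empty using (⊥-elim)
open import Data.Unit using (tt)
open import Data.Nat as ℕ using (ℕ; zero; suc; _+_; _*_; _<_; _≤_; z≤n; s≤s; z<s)
open import Data.Nat.Properties using (anyUpTo?; m≤m+n; <-≤-trans; <⇒≤; ≤-trans; <⇒≱; <⇒≢; +-cancelˡ-≡)
open import Data.Fin as Fin using (Fin; zero; suc; fromℕ; inject₁; toℕ; _↑ˡ_; _↑ʳ_; splitAt; combine; remQuot)
open import Data.Fin.Properties using (any?; all?; _≟_; injective⇒≤; toℕ<n; toℕ-injective; ↑ˡ-injective; ↑ʳ-injective; splitAt-↑ˡ; splitAt-↑ʳ; splitAt⁻¹-↑ˡ; splitAt⁻¹-↑ʳ; remQuot-combine)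
open import Data.Vec using (Vec; []; _∷_; lookup; tabulate)
open import Data.Vec.Properties using (lookup∘tabulate)
open import Data.Vec.Relation.Unary.All using (All; []; _∷_)
open import Data.Vec.Relation.Unary.All.Properties using (tabulate⁺)
open import Data.List using (List; []; _∷_)
open import Data.List.Relation.Unary.Any as Any using (here)
open import Data.List.Membership.Propositional using (_∈_; find; lose)
open import Data.List.Membership.DecPropositional ℕ._≟_ using (_∈?_)
open import Data.Product using (Σ; ∃₂; ∃-syntax; _×_; _,_; proj₁; proj₂)
open import Data.Sum using (_⊎_; inj₁; inj₂)
open import Function.Base using (_∘_)
open import Function.Bundles using (_⇔_; mk⇔)
open import Function.Definitions using (Injective)
open import Relation.Binary.Core using (Rel)
open import Relation.Binary.Definitions using (Irreflexive) renaming (Decidable to Decidable₂)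
open import Relation.Binary.PropositionalEquality using (_≡_; _≢_; refl; sym; trans; cong; cong₂; subst₂; _≗_)
open import Relation.Nullary using (Dec; yes; no; ¬?)
open import Relation.Nullary.Decidable using (map′; _×-dec_; _→-dec_)
open import Relation.Unary using (Pred; Decidable; U)

Searchable : {A : Set} → Pred A 0ℓ → Set₁
Searchable {A} R = {P : Pred A 0ℓ} → Decidable P → Dec (∃[ a ] R a × P a)

searchable-Fin : ∀ {n} → Searchable {Fin n} U
searchable-Fin P? = map′ (λ (a , p) → a , tt , p) (λ (a , _ , p) → a , p) (any? P?)

searchable-∈ : {A : Set} (xs : List A) → Searchable (_∈ xs)
searchable-∈ xs P? = map′ find (λ (_ , x∈xs , p) → lose x∈xs p) (Any.any? P? xs)

searchable-All : {A : Set} {R : Pred A 0ℓ} → Searchable R → ∀ k → Searchable {Vec A k} (All R)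
searchable-All search zero P? = map′ (λ p → [] , [] , p) (λ { ([] , [] , p) → p }) (P? [])
searchable-All search (suc k) P? =
  map′ (λ (a , r , xs , rs , p) → a ∷ xs , r ∷ rs , p)
       (λ { (a ∷ xs , r ∷ rs , p) → a , r , xs , rs , p })
       (search λ a → searchable-All search k λ xs → P? (a ∷ xs))

Timestamp : TemporalGraph → Pred ℕ 0ℓ
Timestamp G t = ∃₂ λ a b → t ∈ label G a b

searchable-Timestamp : (G : TemporalGraph) → Searchable (Timestamp G)
searchable-Timestamp G P? =
  map′ (λ (a , b , t , t∈ , p) → t , (a , b , t∈) , p)
       (λ (t , (a , b , t∈) , p) → a , b , t , t∈ , p)
       (any? λ a → any? λ b → searchable-∈ (label G a b) P?)

module _ (G : TemporalGraph) (u v : V G) where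

  IsStrictTemporalPath : (k : ℕ) → (Fin (suc k) → V G) → (Fin k → ℕ) → Set
  IsStrictTemporalPath k x t =
    0 < k × Injective _≡_ _≡_ x × x zero ≡ u × x (fromℕ k) ≡ v ×
    (∀ i → t i ∈ label G (x (inject₁ i)) (x (suc i))) ×
    (∀ i j → i Fin.< j → t i < t j)

  isStrictTemporalPath? : ∀ k x t → Dec (IsStrictTemporalPath k x t)
  isStrictTemporalPath? k x t =
    0 ℕ.<? k ×-dec injective? ×-dec x zero ≟ u ×-dec x (fromℕ k) ≟ v ×-dec
    all? (λ i → t i ∈? label G (x (inject₁ i)) (x (suc i))) ×-dec
    all? (λ i → all? λ j → i Fin.<? j →-dec t i ℕ.<? t j)
    where
    injective? : Dec (Injective _≡_ _≡_ x)
    injective? = map′ (λ f {i} {j} → f i j) (λ f i j → f) (all? λ i → all? λ j → x i ≟ x j →-dec i ≟ j)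

  IsStrictTemporalPath-resp : ∀ {k x x′ t t′} → x ≗ x′ → t ≗ t′ →
    IsStrictTemporalPath k x t → IsStrictTemporalPath k x′ t′
  IsStrictTemporalPath-resp {x = x} {x′} {t} {t′} x≗x′ t≗t′ (k>0 , injective , start , end , onArc , strict) =
    k>0 ,
    (λ e → injective (trans (x≗x′ _) (trans e (sym (x≗x′ _))))) ,
    trans (sym (x≗x′ zero)) start ,
    trans (sym (x≗x′ _)) end ,
    (λ i → ∈-resp (onArc i)) ,
    (λ i j i<j → subst₂ _<_ (t≗t′ i) (t≗t′ j) (strict i j i<j))
    where
    ∈-resp : ∀ {i} → t i ∈ label G (x (inject₁ i)) (x (suc i)) → t′ i ∈ label G (x′ (inject₁ i)) (x′ (suc i))
    ∈-resp {i} = subst₂ _∈_ (t≗t′ i) (cong₂ (label G) (x≗x′ (inject₁ i)) (x≗x′ (suc i)))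

  fromIsStrictTemporalPath : ∀ {k x t} → IsStrictTemporalPath k x t → StrictTemporalPath G u v
  fromIsStrictTemporalPath {k} {x} {t} (k>0 , injective , start , end , onArc , strict) = record
    { k = k ; kPos = k>0 ; vert = x ; distinct = injective ; start = start ; end = end
    ; time = t ; onArc = onArc ; strict = strict }

  toIsStrictTemporalPath : (P : StrictTemporalPath G u v) →
    let open StrictTemporalPath P in IsStrictTemporalPath k vert time
  toIsStrictTemporalPath P = kPos , distinct , start , end , onArc , strict
    where open StrictTemporalPath P

  -- A path visits at most n vertices, hence has length below n.
  strictTemporalPath? : Dec (StrictTemporalPath G u v)
  strictTemporalPath? = map′ fromWitness toWitness
    (anyUpTo? (λ k → searchable-All searchable-Fin (suc k) λ xs →
                     searchable-All (searchable-Timestamp G) k λ ts →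
                     isStrictTemporalPath? k (lookup xs) (lookup ts))
              (n G))
    where
    Witness : Set
    Witness = ∃[ k ] k < n G × ∃[ xs ] All U xs × ∃[ ts ] All (Timestamp G) ts ×
              IsStrictTemporalPath k (lookup xs) (lookup ts)

    fromWitness : Witness → StrictTemporalPath G u v
    fromWitness (_ , _ , _ , _ , _ , _ , path) = fromIsStrictTemporalPath path

    toWitness : StrictTemporalPath G u v → Witness
    toWitness P =
      k , injective⇒≤ distinct ,
      tabulate vert , tabulate⁺ {f = vert} (λ _ → tt) ,
      tabulate time , tabulate⁺ (λ i → _ , _ , onArc i) ,
      IsStrictTemporalPath-resp (sym ∘ lookup∘tabulate vert) (sym ∘ lookup∘tabulate time)
        (toIsStrictTemporalPath P)
      where open StrictTemporalPath P

reachArc? : (G : TemporalGraph) → Decidable₂ (ReachArc G)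
reachArc? G u v = ¬? (u ≟ v) ×-dec strictTemporalPath? G u v

ReachArc-irreflexive : (G : TemporalGraph) → Irreflexive _≡_ (ReachArc G)
ReachArc-irreflexive G u≡v (u≢v , _) = u≢v u≡v

strictTemporalPath₂ : (G : TemporalGraph) {x y z : V G} {t t′ : ℕ} →
  x ≢ y → y ≢ z → x ≢ z → t ∈ label G x y → t′ ∈ label G y z → t < t′ →
  StrictTemporalPath G x z
strictTemporalPath₂ G {x} {y} {z} {t} {t′} x≢y y≢z x≢z t∈xy t′∈yz t<t′ = record
  { k = 2 ; kPos = z<s ; vert = vert ; distinct = distinct ; start = refl ; end = refl
  ; time = time ; onArc = onArc ; strict = strict }
  where
  vert : Fin 3 → V G
  vert zero             = x
  vert (suc zero)       = y
  vert (suc (suc zero)) = z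

  distinct : Injective _≡_ _≡_ vert
  distinct {zero}             {zero}             _ = refl
  distinct {zero}             {suc zero}         e = ⊥-elim (x≢y e)
  distinct {zero}             {suc (suc zero)}   e = ⊥-elim (x≢z e)
  distinct {suc zero}         {zero}             e = ⊥-elim (x≢y (sym e))
  distinct {suc zero}         {suc zero}         _ = refl
  distinct {suc zero}         {suc (suc zero)}   e = ⊥-elim (y≢z e)
  distinct {suc (suc zero)}   {zero}             e = ⊥-elim (x≢z (sym e))
  distinct {suc (suc zero)}   {suc zero}         e = ⊥-elim (y≢z (sym e))
  distinct {suc (suc zero)}   {suc (suc zero)}   _ = refl

  time : Fin 2 → ℕ
  time zero       = t
  time (suc zero) = t′

  onArc : ∀ i → time i ∈ label G (vert (inject₁ i)) (vert (suc i))
  onArc zero       = t∈xy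
  onArc (suc zero) = t′∈yz

  strict : ∀ i j → i Fin.< j → time i < time j
  strict zero       (suc zero) _ = t<t′
  strict (suc zero) (suc zero) (s≤s ())

Simple-if-single : (G : TemporalGraph) →
  (∀ a b → label G a b ≡ [] ⊎ Σ ℕ λ t → label G a b ≡ t ∷ []) → Simple G
Simple-if-single G single a b arc with single a b
... | inj₁ empty     = ⊥-elim (arc empty)
... | inj₂ singleton = singleton

Proper-if-labels-unique : (G : TemporalGraph) →
  (∀ {a b c d t} → t ∈ label G a b → t ∈ label G c d → a ≡ c × b ≡ d) → Proper G
Proper-if-labels-unique G unique a b c d _ _ distinctArcs _ t t∈ab t∈cd = distinctArcs (unique t∈ab t∈cd)

singletonIf : {A : Set} → Dec A → ℕ → List ℕ
singletonIf (yes _) t = t ∷ []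
singletonIf (no _)  _ = []

singletonIf-single : {A : Set} (d : Dec A) (t : ℕ) →
  singletonIf d t ≡ [] ⊎ Σ ℕ λ t′ → singletonIf d t ≡ t′ ∷ []
singletonIf-single (yes _) t = inj₂ (t , refl)
singletonIf-single (no _)  _ = inj₁ refl

∈-singletonIf⁻ : {A : Set} (d : Dec A) {s t : ℕ} → s ∈ singletonIf d t → A × s ≡ t
∈-singletonIf⁻ (yes a) (here s≡t) = a , s≡t

∈-singletonIf⁺ : {A : Set} (d : Dec A) {t : ℕ} → A → t ∈ singletonIf d t
∈-singletonIf⁺ (yes _) _ = here refl
∈-singletonIf⁺ (no ¬a) a = ⊥-elim (¬a a)

module Gadget {n : ℕ} {D : Rel (Fin n) 0ℓ} (D? : Decidable₂ D) (irreflexive : Irreflexive _≡_ D) where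

  m : ℕ
  m = n * n

  source target : Fin m → Fin n
  source p = proj₁ (remQuot {n} n p)
  target p = proj₂ (remQuot {n} n p)

  source-target-surjective : ∀ a b → ∃[ p ] source p ≡ a × target p ≡ b
  source-target-surjective a b = combine a b , cong proj₁ (remQuot-combine a b) , cong proj₂ (remQuot-combine a b)

  Related : Pred (Fin m) 0ℓ
  Related p = D (source p) (target p)

  gadgetLabel : Fin n ⊎ Fin m → Fin n ⊎ Fin m → List ℕ
  gadgetLabel (inj₁ a) (inj₂ p) = singletonIf (a ≟ source p ×-dec D? (source p) (target p)) (toℕ p)
  gadgetLabel (inj₂ p) (inj₁ b) = singletonIf (b ≟ target p ×-dec D? (source p) (target p)) (m + toℕ p)
  gadgetLabel _        _        = []

  gadgetLabel-irrefl : ∀ s → gadgetLabel s s ≡ []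
  gadgetLabel-irrefl (inj₁ _) = refl
  gadgetLabel-irrefl (inj₂ _) = refl

  gadgetLabel-single : ∀ s s′ → gadgetLabel s s′ ≡ [] ⊎ Σ ℕ λ t → gadgetLabel s s′ ≡ t ∷ []
  gadgetLabel-single (inj₁ _) (inj₁ _) = inj₁ refl
  gadgetLabel-single (inj₁ _) (inj₂ _) = singletonIf-single _ _
  gadgetLabel-single (inj₂ _) (inj₁ _) = singletonIf-single _ _
  gadgetLabel-single (inj₂ _) (inj₂ _) = inj₁ refl

  H : TemporalGraph
  H = record
    { n      = n + m
    ; label  = λ x y → gadgetLabel (splitAt n x) (splitAt n y)
    ; noLoop = gadgetLabel-irrefl ∘ splitAt n
    }

  base : Fin n → V H
  base a = a ↑ˡ m

  pair : Fin m → V H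
  pair p = n ↑ʳ p

  base-injective : ∀ {a b} → base a ≡ base b → a ≡ b
  base-injective = ↑ˡ-injective m _ _

  base≢pair : ∀ {a p} → base a ≢ pair p
  base≢pair {a} {p} e with trans (sym (splitAt-↑ˡ n a m)) (trans (cong (splitAt n) e) (splitAt-↑ʳ n m p))
  ... | ()

  data Arc : V H → V H → ℕ → Set where
    up   : ∀ p → Related p → Arc (base (source p)) (pair p) (toℕ p)
    down : ∀ p → Related p → Arc (pair p) (base (target p)) (m + toℕ p)

  ∈-label⁻ : ∀ {x y t} → t ∈ label H x y → Arc x y t
  ∈-label⁻ {x} {y} t∈ with splitAt n x in sx | splitAt n y in sy
  ... | inj₁ a | inj₂ p
    with (refl , related) , refl ← ∈-singletonIf⁻ (a ≟ source p ×-dec D? (source p) (target p)) t∈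
    with refl ← splitAt⁻¹-↑ˡ sx | refl ← splitAt⁻¹-↑ʳ sy = up p related
  ... | inj₂ p | inj₁ b
    with (refl , related) , refl ← ∈-singletonIf⁻ (b ≟ target p ×-dec D? (source p) (target p)) t∈
    with refl ← splitAt⁻¹-↑ʳ sx | refl ← splitAt⁻¹-↑ˡ sy = down p related

  up∈label : ∀ p → Related p → toℕ p ∈ label H (base (source p)) (pair p)
  up∈label p related rewrite splitAt-↑ˡ n (source p) m | splitAt-↑ʳ n m p =
    ∈-singletonIf⁺ (source p ≟ source p ×-dec D? (source p) (target p)) (refl , related)

  down∈label : ∀ p → Related p → m + toℕ p ∈ label H (pair p) (base (target p))
  down∈label p related rewrite splitAt-↑ʳ n m p | splitAt-↑ˡ n (target p) m =
    ∈-singletonIf⁺ (target p ≟ target p ×-dec D? (source p) (target p)) (refl , related)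

  up<down : ∀ (p q : Fin m) → toℕ p < m + toℕ q
  up<down p q = <-≤-trans (toℕ<n p) (m≤m+n m (toℕ q))

  Arc-unique : ∀ {a b c d t t′} → Arc a b t → Arc c d t′ → t ≡ t′ → a ≡ c × b ≡ d
  Arc-unique (up p _)   (up q _)   e with refl ← toℕ-injective e = refl , refl
  Arc-unique (up p _)   (down q _) e = ⊥-elim (<⇒≢ (up<down p q) e)
  Arc-unique (down p _) (up q _)   e = ⊥-elim (<⇒≢ (up<down q p) (sym e))
  Arc-unique (down p _) (down q _) e with refl ← toℕ-injective (+-cancelˡ-≡ m _ _ e) = refl , refl

  leaving-base : ∀ {x y a t} → t ∈ label H x y → x ≡ base a → ∃[ p ] y ≡ pair p × source p ≡ a × t < m
  leaving-base t∈ x≡a with ∈-label⁻ t∈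
  ... | up p _   = p , refl , base-injective x≡a , toℕ<n p
  ... | down _ _ = ⊥-elim (base≢pair (sym x≡a))

  leaving-pair : ∀ {x y p t} → t ∈ label H x y → x ≡ pair p → y ≡ base (target p) × m ≤ t × Related p
  leaving-pair t∈ x≡p with ∈-label⁻ t∈
  ... | up _ _ = ⊥-elim (base≢pair x≡p)
  ... | down q related with refl ← ↑ʳ-injective n _ _ x≡p = refl , m≤m+n m (toℕ q) , related

  H-simple : Simple H
  H-simple = Simple-if-single H λ x y → gadgetLabel-single (splitAt n x) (splitAt n y)

  H-proper : Proper H
  H-proper = Proper-if-labels-unique H λ t∈ab t∈cd → Arc-unique (∈-label⁻ t∈ab) (∈-label⁻ t∈cd) refl

  reachable⇒related : ∀ {a b} → StrictTemporalPath H (base a) (base b) → D a b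
  reachable⇒related record { k = suc zero ; start = start ; end = end ; onArc = onArc }
    with _ , x₁≡p , _ ← leaving-base (onArc zero) start
    = ⊥-elim (base≢pair (trans (sym end) x₁≡p))
  reachable⇒related record { k = suc (suc zero) ; start = start ; end = end ; onArc = onArc }
    with p , x₁≡p , refl , _ ← leaving-base (onArc zero) start
    with x₂≡p₂ , _ , related ← leaving-pair (onArc (suc zero)) x₁≡p
    with refl ← base-injective (trans (sym x₂≡p₂) end)
    = related
  reachable⇒related record { k = suc (suc (suc _)) ; start = start ; onArc = onArc ; strict = strict }
    with _ , x₁≡p , _ ← leaving-base (onArc zero) start
    with x₂≡p₂ , m≤t₁ , _ ← leaving-pair (onArc (suc zero)) x₁≡p
    with _ , _ , _ , t₂<m ← leaving-base (onArc (suc (suc zero))) x₂≡p₂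
    = ⊥-elim (<⇒≱ (strict (suc zero) (suc (suc zero)) (s≤s (s≤s z≤n))) (≤-trans (<⇒≤ t₂<m) m≤t₁))

  related⇒reachArc : ∀ {a b} → D a b → ReachArc H (base a) (base b)
  related⇒reachArc {a} {b} related
    with p , refl , refl ← source-target-surjective a b
    = base≢base , strictTemporalPath₂ H base≢pair (base≢pair ∘ sym) base≢base
                    (up∈label p related) (down∈label p related) (up<down p p)
    where
    base≢base : base (source p) ≢ base (target p)
    base≢base e = irreflexive (base-injective e) related

reachabilityRealisation : ∀ {n} {D : Rel (Fin n) 0ℓ} → Decidable₂ D → Irreflexive _≡_ D →
  Σ TemporalGraph λ H → Simple H × Proper H ×
    Σ (Fin n → V H) λ σ → (a b : Fin n) → D a b ⇔ ReachArc H (σ a) (σ b)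
reachabilityRealisation D? irreflexive =
  H , H-simple , H-proper , base , λ _ _ → mk⇔ related⇒reachArc (reachable⇒related ∘ proj₂)
  where open Gadget D? irreflexive

theorem20 : (G : TemporalGraph) →
    Σ TemporalGraph λ H → Simple H × Proper H ×
      Σ (V G → V H) λ σ → (u v : V G) → ReachArc G u v ⇔ ReachArc H (σ u) (σ v)
theorem20 G = reachabilityRealisation (reachArc? G) (ReachArc-irreflexive G)
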